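{- Let $A$ be the well-formed environment $\{\!\{e_1,nl_1,ol_1,\{\!\{e_2,nl_2,ol_3,e_3\}\!\}\}\!\}$ where $e_2 = (t_2,nl_2)::e_2'$ and $e_3=(t_3,n_3)::e_3'$. Let $B$ be the environment $\{\!\{e_1,nl_1,ol_1,([\![t_2,ol_3,n_3,e_3]\!],\, n_3+(nl_2\mathbin{\dot- } ol_3))::\{\!\{e_2',nl_2,ol_3,e_3\}\!\}\}\!\}$. If $A\rhd_{rm}^* C$ for a simple environment $C$, then also $B\rhd_{rm}^* C$.
   Context: Suspension calculus with meta variables. Terms $t ::= c \mid v \mid \#i \mid (t\ t)\mid(\lambda\, t)\mid [\![t,n,n,e]\!]$, environments $e::= nil\mid ((t,n)::e)\mid \{\!\{e,n,n,e\}\!\}$ ($c$ constants, $v$ meta variables, $n$ naturals, $i$ positive integers). $m\mathbin{\dot- } n=\max(m-n,0)$. Length: $len(nil)=0$, $len((t,l)::e)=1+len(e)$, $len(\{\!\{e_1,nl_1,ol_2,e_2\}\!\})=len(e_1)+(len(e_2)\mathbin{\dot- } nl_1)$. Level: $lev(nil)=0$, $lev((t,l)::e)=l$, $lev(\{\!\{e_1,nl_1,ol_2,e_2\}\!\})=lev(e_2)+(nl_1\mathbin{\dot- } ol_2)$. Well-formed: every subexpression satisfies: $[\![t,ol,nl,e]\!]$ has $len(e)=ol$, $lev(e)\le nl$; $(t,l)::e$ has $l\ge lev(e)$; $\{\!\{e_1,nl_1,ol_2,e_2\}\!\}$ has $lev(e_1)\le nl_1$, $len(e_2)=ol_2$.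 Only well-formed expressions are considered. A simple environment is one of the form $(t_0,l_0)::\cdots::(t_{k-1},l_{k-1})::nil$ ($k\ge 0$). Reading rules: (r1) $[\![c,ol,nl,e]\!]\to c$; (r2) $[\![\#i,0,nl,nil]\!]\to\#(i+nl)$; (r3) $[\![\#1,ol,nl,(t,l)::e]\!]\to[\![t,0,nl-l,nil]\!]$; (r4) $[\![\#i,ol,nl,(t,l)::e]\!]\to[\![\#(i-1),ol-1,nl,e]\!]$ if $i>1$; (r5) $[\![(t_1\ t_2),ol,nl,e]\!]\to([\![t_1,ol,nl,e]\!]\ [\![t_2,ol,nl,e]\!])$; (r6) $[\![(\lambda t),ol,nl,e]\!]\to(\lambda [\![t,ol+1,nl+1,(\#1,nl+1)::e]\!])$. Merging rules: (m1) $[\![[\![t,ol_1,nl_1,e_1]\!],ol_2,nl_2,e_2]\!]\to[\![t,ol_1+(ol_2\mathbin{\dot- } nl_1),nl_2+(nl_1\mathbin{\dot- } ol_2),\{\!\{e_1,nl_1,ol_2,e_2\}\!\}]\!]$; (m2) $\{\!\{e_1,nl_1,0,nil\}\!\}\to e_1$; (m3) $\{\!\{nil,0,ol_2,e_2\}\!\}\to e_2$; (m4) $\{\!\{nil,nl_1,ol_2,(t,l)::e_2\}\!\}\to\{\!\{nil,nl_1-1,ol_2-1,e_2\}\!\}$ if $nl_1\ge1$; (m5) $\{\!\{(t,n)::e_1,nl_1,ol_2,(s,l)::e_2\}\!\}\to\{\!\{(t,n)::e_1,nl_1-1,ol_2-1,e_2\}\!\}$ if $nl_1>n$; (m6) $\{\!\{(t,n)::e_1,n,ol_2,(s,l)::e_2\}\!\}\to([\![t,ol_2,l,(s,l)::e_2]\!],l+(n\mathbin{\dot-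 } ol_2))::\{\!\{e_1,n,ol_2,(s,l)::e_2\}\!\}$. No rule acts on meta variables. $x\rhd_{rm}y$: $y$ results from $x$ by one of these rules at some subexpression; $\rhd_{rm}^*$ is its reflexive–transitive closure. -}

module Defs where

open import Data.Nat using (ℕ; zero; suc; _+_; _∸_; _≤_; _<_)
open import Data.Product using (_×_)
open import Data.Unit using (⊤)
open import Relation.Binary.PropositionalEquality using (_≡_)
open import Relation.Binary.Construct.Closure.ReflexiveTransitive using (Star)

-- De Bruijn index #i is `# i` with i : ℕ; positivity (i ≥ 1) is part of
-- well-formedness.
mutual
  data Tm : Set where
    con  : ℕ → Tm
    meta : ℕ → Tm
    #_   : ℕ → Tm
    app  : Tm → Tm → Tm
    lam  : Tm → Tm
    ⟦_,_,_,_⟧ : Tm → ℕ → ℕ → Env → Tm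

  data Env : Set where
    nil   : Env
    _,_∷_ : Tm → ℕ → Env → Env
    ⦃⦃_,_,_,_⦄⦄ : Env → ℕ → ℕ → Env → Env

infixr 5 _,_∷_
infix 30 #_
infix 4 _▷ᵗ_ _▷ᵉ_ _▷*ᵉ_

len : Env → ℕ
len nil = 0
len (t , l ∷ e) = suc (len e)
len ⦃⦃ e₁ , nl₁ , ol₂ , e₂ ⦄⦄ = len e₁ + (len e₂ ∸ nl₁)

lev : Env → ℕ
lev nil = 0
lev (t , l ∷ e) = l
lev ⦃⦃ e₁ , nl₁ , ol₂ , e₂ ⦄⦄ = lev e₂ + (nl₁ ∸ ol₂)

mutual
  WFt : Tm → Set
  WFt (con c) = ⊤
  WFt (meta v) = ⊤
  WFt (# i) = 1 ≤ i
  WFt (app t₁ t₂) = WFt t₁ × WFt t₂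
  WFt (lam t) = WFt t
  WFt ⟦ t , ol , nl , e ⟧ = WFt t × WFe e × len e ≡ ol × lev e ≤ nl

  WFe : Env → Set
  WFe nil = ⊤
  WFe (t , l ∷ e) = WFt t × WFe e × lev e ≤ l
  WFe ⦃⦃ e₁ , nl₁ , ol₂ , e₂ ⦄⦄ = WFe e₁ × WFe e₂ × lev e₁ ≤ nl₁ × len e₂ ≡ ol₂

data Simple : Env → Set where
  nil  : Simple nil
  cons : ∀ {t l e} → Simple e → Simple (t , l ∷ e)

mutual
  data _▷ᵗ_ : Tm → Tm → Set where
    r1 : ∀ {c ol nl e} → ⟦ con c , ol , nl , e ⟧ ▷ᵗ con c
    r2 : ∀ {i nl} → ⟦ # i , 0 , nl , nil ⟧ ▷ᵗ # (i + nl)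
    r3 : ∀ {ol nl t l e} → ⟦ # 1 , ol , nl , (t , l ∷ e) ⟧ ▷ᵗ ⟦ t , 0 , nl ∸ l , nil ⟧
    r4 : ∀ {i ol nl t l e} → 1 < i →
         ⟦ # i , ol , nl , (t , l ∷ e) ⟧ ▷ᵗ ⟦ # (i ∸ 1) , ol ∸ 1 , nl , e ⟧
    r5 : ∀ {t₁ t₂ ol nl e} →
         ⟦ app t₁ t₂ , ol , nl , e ⟧ ▷ᵗ app ⟦ t₁ , ol , nl , e ⟧ ⟦ t₂ , ol , nl , e ⟧
    r6 : ∀ {t ol nl e} →
         ⟦ lam t , ol , nl , e ⟧ ▷ᵗ lam ⟦ t , suc ol , suc nl , (# 1 , suc nl ∷ e) ⟧
    m1 : ∀ {t ol₁ nl₁ e₁ ol₂ nl₂ e₂} →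
         ⟦ ⟦ t , ol₁ , nl₁ , e₁ ⟧ , ol₂ , nl₂ , e₂ ⟧ ▷ᵗ
         ⟦ t , ol₁ + (ol₂ ∸ nl₁) , nl₂ + (nl₁ ∸ ol₂) , ⦃⦃ e₁ , nl₁ , ol₂ , e₂ ⦄⦄ ⟧
    appˡ : ∀ {t t' s} → t ▷ᵗ t' → app t s ▷ᵗ app t' s
    appʳ : ∀ {t s s'} → s ▷ᵗ s' → app t s ▷ᵗ app t s'
    lamᶜ : ∀ {t t'} → t ▷ᵗ t' → lam t ▷ᵗ lam t'
    suspᵗ : ∀ {t t' ol nl e} → t ▷ᵗ t' → ⟦ t , ol , nl , e ⟧ ▷ᵗ ⟦ t' , ol , nl , e ⟧
    suspᵉ : ∀ {t ol nl e e'} → e ▷ᵉ e' → ⟦ t , ol , nl , e ⟧ ▷ᵗ ⟦ t , ol , nl , e' ⟧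

  data _▷ᵉ_ : Env → Env → Set where
    m2 : ∀ {e₁ nl₁} → ⦃⦃ e₁ , nl₁ , 0 , nil ⦄⦄ ▷ᵉ e₁
    m3 : ∀ {ol₂ e₂} → ⦃⦃ nil , 0 , ol₂ , e₂ ⦄⦄ ▷ᵉ e₂
    m4 : ∀ {nl₁ ol₂ t l e₂} → 1 ≤ nl₁ →
         ⦃⦃ nil , nl₁ , ol₂ , (t , l ∷ e₂) ⦄⦄ ▷ᵉ ⦃⦃ nil , nl₁ ∸ 1 , ol₂ ∸ 1 , e₂ ⦄⦄
    m5 : ∀ {t n e₁ nl₁ ol₂ s l e₂} → n < nl₁ →
         ⦃⦃ (t , n ∷ e₁) , nl₁ , ol₂ , (s , l ∷ e₂) ⦄⦄ ▷ᵉ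
         ⦃⦃ (t , n ∷ e₁) , nl₁ ∸ 1 , ol₂ ∸ 1 , e₂ ⦄⦄
    m6 : ∀ {t n e₁ ol₂ s l e₂} →
         ⦃⦃ (t , n ∷ e₁) , n , ol₂ , (s , l ∷ e₂) ⦄⦄ ▷ᵉ
         (⟦ t , ol₂ , l , (s , l ∷ e₂) ⟧ , l + (n ∸ ol₂) ∷ ⦃⦃ e₁ , n , ol₂ , (s , l ∷ e₂) ⦄⦄)
    consᵗ : ∀ {t t' l e} → t ▷ᵗ t' → (t , l ∷ e) ▷ᵉ (t' , l ∷ e)
    consᵉ : ∀ {t l e e'} → e ▷ᵉ e' → (t , l ∷ e) ▷ᵉ (t , l ∷ e')
    mergeˡ : ∀ {e₁ e₁' nl₁ ol₂ e₂} → e₁ ▷ᵉ e₁' → ⦃⦃ e₁ , nl₁ , ol₂ , e₂ ⦄⦄ ▷ᵉ ⦃⦃ e₁' , nl₁ , ol₂ , e₂ ⦄⦄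
    mergeʳ : ∀ {e₁ nl₁ ol₂ e₂ e₂'} → e₂ ▷ᵉ e₂' → ⦃⦃ e₁ , nl₁ , ol₂ , e₂ ⦄⦄ ▷ᵉ ⦃⦃ e₁ , nl₁ , ol₂ , e₂' ⦄⦄

_▷*ᵉ_ : Env → Env → Set
_▷*ᵉ_ = Star _▷ᵉ_

module Submission where

open import Defs
open import Data.Nat using (ℕ; _+_; _∸_)
open import Data.Nat.Properties using (<-irrefl)
open import Data.Product using (∃; _×_; _,_)
open import Data.Sum using (_⊎_; inj₁; inj₂)
open import Data.Empty using (⊥-elim)
open import Relation.Nullary using (¬_)
open import Relation.Binary.PropositionalEquality using (_≡_; refl)
open import Relation.Binary.Construct.Closure.ReflexiveTransitive
  using (ε; _◅_; _◅◅_; gmap)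

-- Contracting an m6 redex, possibly nested in the right operands of merges,
-- commutes with every other step out of it: a step inside the redex is
-- mirrored by at most two steps of the contractum, m5 is blocked since it
-- needs n < n, and a surrounding merge can only fire m3 or reduce its left
-- operand.  A simple environment is never a merge, so a reduction to one must
-- eventually fire the m6 step itself, at which point the contractum has caught up.

infix 4 _▷m6_

data _▷m6_ : Env → Env → Set where
  here   : ∀ {t n e₁ ol s l e₂} →
           ⦃⦃ (t , n ∷ e₁) , n , ol , (s , l ∷ e₂) ⦄⦄ ▷m6
           (⟦ t , ol , l , (s , l ∷ e₂) ⟧ , l + (n ∸ ol) ∷ ⦃⦃ e₁ , n , ol , (s , l ∷ e₂) ⦄⦄)
  mergeʳ : ∀ {e₁ nl ol A B} → A ▷m6 B → ⦃⦃ e₁ , nl , ol , A ⦄⦄ ▷m6 ⦃⦃ e₁ , nl , ol , B ⦄⦄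

▷m6-source-¬Simple : ∀ {A B} → A ▷m6 B → ¬ Simple A
▷m6-source-¬Simple here ()
▷m6-source-¬Simple (mergeʳ _) ()

▷ᵉ-from-▷m6 : ∀ {A A' B} → A ▷m6 B → A ▷ᵉ A' →
              ∃ λ B' → B ▷*ᵉ B' × (A' ≡ B' ⊎ A' ▷m6 B')
▷ᵉ-from-▷m6 here (m5 n<n) with () ← <-irrefl refl n<n
▷ᵉ-from-▷m6 here m6 = _ , ε , inj₁ refl
▷ᵉ-from-▷m6 here (mergeˡ (consᵗ s)) =
  _ , consᵗ (suspᵗ s) ◅ ε , inj₂ here
▷ᵉ-from-▷m6 here (mergeˡ (consᵉ s)) =
  _ , consᵉ (mergeˡ s) ◅ ε , inj₂ here
▷ᵉ-from-▷m6 here (mergeʳ (consᵗ s)) =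
  _ , consᵗ (suspᵉ (consᵗ s)) ◅ consᵉ (mergeʳ (consᵗ s)) ◅ ε , inj₂ here
▷ᵉ-from-▷m6 here (mergeʳ (consᵉ s)) =
  _ , consᵗ (suspᵉ (consᵉ s)) ◅ consᵉ (mergeʳ (consᵉ s)) ◅ ε , inj₂ here
▷ᵉ-from-▷m6 (mergeʳ A▷B) m3 = _ , m3 ◅ ε , inj₂ A▷B
▷ᵉ-from-▷m6 (mergeʳ A▷B) (mergeˡ s) = _ , mergeˡ s ◅ ε , inj₂ (mergeʳ A▷B)
▷ᵉ-from-▷m6 (mergeʳ A▷B) (mergeʳ s) with ▷ᵉ-from-▷m6 A▷B s
... | B' , B▷*B' , inj₁ refl   = _ , gmap _ mergeʳ B▷*B' , inj₁ refl
... | B' , B▷*B' , inj₂ A'▷B'  = _ , gmap _ mergeʳ B▷*B' , inj₂ (mergeʳ A'▷B')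

▷m6-postpone : ∀ {A B C} → A ▷m6 B → Simple C → A ▷*ᵉ C → B ▷*ᵉ C
▷m6-postpone A▷B sC ε = ⊥-elim (▷m6-source-¬Simple A▷B sC)
▷m6-postpone A▷B sC (s ◅ r) with ▷ᵉ-from-▷m6 A▷B s
... | _ , B▷*B' , inj₁ refl   = B▷*B' ◅◅ r
... | _ , B▷*B' , inj₂ A'▷B'  = B▷*B' ◅◅ ▷m6-postpone A'▷B' sC r

lemma3p8 : ∀ (e₁ : Env) (nl₁ ol₁ : ℕ) (t₂ : Tm) (nl₂ : ℕ) (e₂' : Env) (ol₃ : ℕ)
             (t₃ : Tm) (n₃ : ℕ) (e₃' : Env) (C : Env) →
           WFe ⦃⦃ e₁ , nl₁ , ol₁ , ⦃⦃ (t₂ , nl₂ ∷ e₂') , nl₂ , ol₃ , (t₃ , n₃ ∷ e₃') ⦄⦄ ⦄⦄ →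
           Simple C →
           ⦃⦃ e₁ , nl₁ , ol₁ , ⦃⦃ (t₂ , nl₂ ∷ e₂') , nl₂ , ol₃ , (t₃ , n₃ ∷ e₃') ⦄⦄ ⦄⦄ ▷*ᵉ C →
           ⦃⦃ e₁ , nl₁ , ol₁ ,
              (⟦ t₂ , ol₃ , n₃ , (t₃ , n₃ ∷ e₃') ⟧ , n₃ + (nl₂ ∸ ol₃)
                 ∷ ⦃⦃ e₂' , nl₂ , ol₃ , (t₃ , n₃ ∷ e₃') ⦄⦄) ⦄⦄ ▷*ᵉ C
lemma3p8 _ _ _ _ _ _ _ _ _ _ _ _ = ▷m6-postpone (mergeʳ here)
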